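{- None of $\overline{C_4}$, the chair and the co-chair belongs to $\mathcal{F}(\vec{\mathcal{P}})$.
   Context: $\overline{C_4}$ is the complement of the 4-cycle (two disjoint edges). The chair is the graph with vertex set $\{x,y,z,t,v\}$ and edges $xy,yz,zt,zv$; the co-chair is its complement. An oriented graph is a digraph with no loops, no parallel arcs and no directed 2-cycles. For a vertex $v$ of an oriented graph $D$, $N^+(v)$ is its out-neighbourhood and $N^{++}(v)=\{x\notin N^+(v): \exists y\in N^+(v), (y,x)\in E(D)\}$. A missing edge of $D$ is a pair of distinct vertices joined by no arc. The missing graph of $D$ has as edges the missing edges of $D$ and as vertices the vertices incident to a missing edge; $D$ is missing $G$ if its missing graph is $G$. A missing edge $x_1y_1$ loses to a missing edge $x_2y_2$ if (with a suitable labelling of endpoints) $x_1\to x_2$, $y_2\notin N^+(x_1)\cup N^{++}(x_1)$, $y_1\to y_2$ and $x_2\notin N^+(y_1)\cup N^{++}(y_1)$. The dependency digraph $\Delta_D$ has the missing edges of $D$ as vertices and an arc from $e$ to $f$ iff $e$ loses to $f$ (it may contain 2-cycles). $\vec{\mathcal{P}}$ is the family of digraphs that are disjoint unions of vertex-disjoint directed paths, and $\mathcal{F}(\vec{\mathcal{P}})$ is the class of graphs $G$ such that for every oriented graph $D$ missing $G$, $\Delta_D\in\vec{\mathcal{P}}$. -}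

module Defs where

open import Data.Nat using (ℕ; zero; suc)
open import Data.Fin using (Fin; toℕ; _<_; _≟_)
open import Data.Bool using (Bool; true; false; not; _∧_; _∨_)
open import Data.Product using (Σ; ∃; ∃-syntax; _×_; _,_)
open import Data.Sum using (_⊎_)
open import Data.List using (List; []; _∷_; _++_; concat)
open import Data.List.Membership.Propositional using (_∈_)
open import Data.List.Relation.Unary.Unique.Propositional using (Unique)
open import Relation.Nullary using (¬_; does)
open import Relation.Binary.PropositionalEquality using (_≡_; _≢_)
open import Function.Bundles using (_⇔_)

record Graph : Set where
  field
    m   : ℕ
    adj : Fin m → Fin m → Bool
open Graph public

Edge : (G : Graph) → Fin (m G) → Fin (m G) → Set
Edge G a b = adj G a b ≡ true

complement : Graph → Graph
complement G = record
  { m = m G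
  ; adj = λ a b → not (adj G a b) ∧ not (does (a ≟ b)) }

private
  c4E : ℕ → ℕ → Bool
  c4E 0 1 = true
  c4E 1 2 = true
  c4E 2 3 = true
  c4E 3 0 = true
  c4E _ _ = false

  -- chair: x=0, y=1, z=2, t=3, v=4 ; edges xy, yz, zt, zv
  chairE : ℕ → ℕ → Bool
  chairE 0 1 = true
  chairE 1 2 = true
  chairE 2 3 = true
  chairE 2 4 = true
  chairE _ _ = false

C4 : Graph
C4 = record { m = 4 ; adj = λ a b → c4E (toℕ a) (toℕ b) ∨ c4E (toℕ b) (toℕ a) }

coC4 : Graph
coC4 = complement C4

chair : Graph
chair = record { m = 5 ; adj = λ a b → chairE (toℕ a) (toℕ b) ∨ chairE (toℕ b) (toℕ a) }

coChair : Graph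
coChair = complement chair

record OrientedGraph : Set where
  field
    n      : ℕ
    arc    : Fin n → Fin n → Bool
    irrefl : ∀ i → arc i i ≡ false
    asym   : ∀ i j → arc i j ≡ true → arc j i ≡ false
open OrientedGraph public

V : OrientedGraph → Set
V D = Fin (n D)

Arc : (D : OrientedGraph) → V D → V D → Set
Arc D i j = arc D i j ≡ true

InN+ : (D : OrientedGraph) → V D → V D → Set
InN+ D x v = Arc D x v

InN++ : (D : OrientedGraph) → V D → V D → Set
InN++ D x v = ¬ Arc D x v × ∃[ y ] (Arc D x y × Arc D y v)

Missing : (D : OrientedGraph) → V D → V D → Set
Missing D i j = i ≢ j × arc D i j ≡ false × arc D j i ≡ false

-- D is missing G: the missing graph of D is isomorphic to G, i.e. there is
-- an injection f from the vertices of G onto the set of vertices of D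
-- incident to a missing edge, with missing edges corresponding to edges.
MissingIs : (D : OrientedGraph) (G : Graph) → Set
MissingIs D G =
  Σ (Fin (m G) → V D) λ f →
    (∀ a b → f a ≡ f b → a ≡ b) ×
    (∀ a → ∃[ y ] Missing D (f a) y) ×
    (∀ x y → Missing D x y → ∃[ a ] f a ≡ x) ×
    (∀ a b → Missing D (f a) (f b) ⇔ Edge G a b)

-- the ordered version of "x1y1 loses to x2y2" (labelling fixed)
LosesLab : (D : OrientedGraph) → V D → V D → V D → V D → Set
LosesLab D x1 y1 x2 y2 =
  Arc D x1 x2 × ¬ (InN+ D x1 y2 ⊎ InN++ D x1 y2) ×
  Arc D y1 y2 × ¬ (InN+ D y1 x2 ⊎ InN++ D y1 x2)

-- Vertices of the dependency digraph: missing edges, each represented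
-- canonically as an ordered pair (a , b) with a < b.
MEdge : OrientedGraph → Set
MEdge D = V D × V D

IsMEdge : (D : OrientedGraph) → MEdge D → Set
IsMEdge D (a , b) = a < b × Missing D a b

Loses : (D : OrientedGraph) → MEdge D → MEdge D → Set
Loses D (a , b) (c , d) =
  LosesLab D a b c d ⊎ LosesLab D a b d c ⊎
  LosesLab D b a c d ⊎ LosesLab D b a d c

Consecutive : {A : Set} → List (List A) → A → A → Set
Consecutive {A} ps e f =
  Σ (List A) λ p → p ∈ ps × ∃[ us ] ∃[ vs ] (p ≡ us ++ e ∷ f ∷ vs)

NonEmpty : {A : Set} → List A → Set
NonEmpty xs = ∃[ y ] ∃[ ys ] (xs ≡ y ∷ ys)

-- Δ_D ∈ P⃗: the vertex set of Δ_D is partitioned into nonempty directed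
-- paths (lists of distinct vertices) and the arcs of Δ_D are exactly the
-- arcs between consecutive vertices of these paths.
DeltaInPaths : OrientedGraph → Set
DeltaInPaths D =
  Σ (List (List (MEdge D))) λ ps →
    (∀ p → p ∈ ps → NonEmpty p) ×
    Unique (concat ps) ×
    (∀ e → (e ∈ concat ps ⇔ IsMEdge D e)) ×
    (∀ e f → IsMEdge D e → IsMEdge D f → (Loses D e f ⇔ Consecutive ps e f))

InFP : Graph → Set
InFP G = (D : OrientedGraph) → MissingIs D G → DeltaInPaths D

-- A disjoint union of directed paths has no 2-cycle, and no vertex of it has
-- two in-neighbours. So it suffices to exhibit, for each of the three graphs,
-- an oriented graph missing it whose dependency digraph violates one of these:
-- for co-C4 the directed 4-cycle 0 → 3 → 2 → 1 → 0, whose two missing edges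
-- lose to each other; for the chair and the co-chair, small orientations in
-- which two missing edges sharing an endpoint both lose to a third one.
module Submission where

open import Defs
open import Data.Product using (_×_)
open import Relation.Nullary using (¬_)

open import Data.Nat using (ℕ)
open import Data.Fin using (Fin; #_; toℕ)
open import Data.Fin.Properties using (all?; any?) renaming (_≟_ to _≟ᶠ_; _<?_ to _<ᶠ?_)
open import Data.Bool using (Bool; true; false)
open import Data.Bool.Properties using () renaming (_≟_ to _≟ᵇ_)
open import Data.Product using (∃-syntax; _,_; proj₁; proj₂; uncurry)
open import Data.Sum using (_⊎_)
open import Data.Empty using (⊥-elim)
open import Data.List using (List; []; _∷_; _++_; concat; [_])
open import Data.List.Properties using (++-assoc; ∷-injective; ∷ʳ-injective)
open import Data.List.Membership.Propositional.Properties using (∈-insert)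
open import Data.List.Relation.Unary.Any using (here; there)
open import Data.List.Relation.Unary.AllPairs using (_∷_)
open import Data.List.Relation.Unary.Unique.Propositional using (Unique)
open import Data.List.Relation.Unary.Unique.Propositional.Properties using (Unique[x∷xs]⇒x∉xs)
open import Relation.Nullary using (Dec)
open import Relation.Nullary.Decidable
  using (True; toWitness; from-yes; map′; ¬?; _×-dec_; _⊎-dec_; _→-dec_)
open import Relation.Binary.PropositionalEquality
  using (_≡_; _≢_; refl; sym; trans; cong; subst; module ≡-Reasoning)
open import Function.Bundles using (_⇔_; mk⇔; Equivalence)

_⇔-dec_ : {A B : Set} → Dec A → Dec B → Dec (A ⇔ B)
a? ⇔-dec b? =
  map′ (uncurry mk⇔) (λ a⇔b → Equivalence.to a⇔b , Equivalence.from a⇔b)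
       ((a? →-dec b?) ×-dec (b? →-dec a?))

module _ {A : Set} where

  Unique-++⁻ʳ : ∀ (xs : List A) {ys} → Unique (xs ++ ys) → Unique ys
  Unique-++⁻ʳ []       u       = u
  Unique-++⁻ʳ (_ ∷ xs) (_ ∷ u) = Unique-++⁻ʳ xs u

  Unique-split : ∀ {x : A} us vs us′ vs′ → Unique (us ++ x ∷ vs) →
                 us ++ x ∷ vs ≡ us′ ++ x ∷ vs′ → us ≡ us′ × vs ≡ vs′
  Unique-split []       _  []        _   _ refl = refl , refl
  Unique-split []       _  (_ ∷ us′) _   u refl = ⊥-elim (Unique[x∷xs]⇒x∉xs u (∈-insert us′))
  Unique-split (_ ∷ us) _  []        _   u refl = ⊥-elim (Unique[x∷xs]⇒x∉xs u (∈-insert us))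
  Unique-split (_ ∷ us) vs (_ ∷ us′) vs′ (_ ∷ u) eq
    with refl , eq′ ← ∷-injective eq
    with refl , refl ← Unique-split us vs us′ vs′ u eq′ = refl , refl

  Adjacent : List A → A → A → Set
  Adjacent xs e f = ∃[ us ] ∃[ vs ] xs ≡ us ++ e ∷ f ∷ vs

  Consecutive⇒Adjacent : ∀ {ps : List (List A)} {e f} → Consecutive ps e f → Adjacent (concat ps) e f
  Consecutive⇒Adjacent {p ∷ ps} (_ , here refl , us , vs , refl) =
    us , vs ++ concat ps , ++-assoc us (_ ∷ _ ∷ vs) (concat ps)
  Consecutive⇒Adjacent {p ∷ ps} (q , there q∈ps , q-split)
    with us , vs , eq ← Consecutive⇒Adjacent (q , q∈ps , q-split) =
    p ++ us , vs , trans (cong (p ++_) eq) (sym (++-assoc p us _))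

  Adjacent-predecessor : ∀ {xs : List A} {e f g} → Unique xs →
                         Adjacent xs f e → Adjacent xs g e → f ≡ g
  Adjacent-predecessor {e = e} {f} {g} u (us , vs , refl) (us′ , vs′ , eq) =
    proj₂ (∷ʳ-injective us us′ (proj₁ (Unique-split (us ++ [ f ]) vs (us′ ++ [ g ]) vs′
      (subst Unique (sym (++-assoc us [ f ] (e ∷ vs))) u) split-at-e)))
    where
      open ≡-Reasoning
      split-at-e : (us ++ [ f ]) ++ e ∷ vs ≡ (us′ ++ [ g ]) ++ e ∷ vs′
      split-at-e = begin
        (us ++ [ f ]) ++ e ∷ vs     ≡⟨ ++-assoc us [ f ] (e ∷ vs) ⟩
        us ++ f ∷ e ∷ vs            ≡⟨ eq ⟩
        us′ ++ g ∷ e ∷ vs′          ≡⟨ ++-assoc us′ [ g ] (e ∷ vs′) ⟨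
        (us′ ++ [ g ]) ++ e ∷ vs′   ∎

  -- Splitting at f shows that e occurs again right after f.
  Adjacent-asym : ∀ {xs : List A} {e f} → Unique xs → Adjacent xs e f → ¬ Adjacent xs f e
  Adjacent-asym {e = e} {f} u (us , vs , refl) (us′ , vs′ , eq)
    with _ , refl ← Unique-split (us ++ [ e ]) vs us′ (e ∷ vs′)
                      (subst Unique (sym (++-assoc us [ e ] (f ∷ vs))) u)
                      (trans (++-assoc us [ e ] (f ∷ vs)) eq)
    = Unique[x∷xs]⇒x∉xs (Unique-++⁻ʳ us u) (there (here refl))

IsOrientation : ∀ {n} → (Fin n → Fin n → Bool) → Set
IsOrientation a = (∀ i → a i i ≡ false) × (∀ i j → a i j ≡ true → a j i ≡ false)

isOrientation? : ∀ {n} (a : Fin n → Fin n → Bool) → Dec (IsOrientation a)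
isOrientation? a =
  all? (λ i → a i i ≟ᵇ false) ×-dec
  all? (λ i → all? λ j → (a i j ≟ᵇ true) →-dec (a j i ≟ᵇ false))

orientedGraph : ∀ {n} (a : Fin n → Fin n → Bool) → {True (isOrientation? a)} → OrientedGraph
orientedGraph a {o} = record
  { arc = a ; irrefl = proj₁ (toWitness o) ; asym = proj₂ (toWitness o) }

module _ (D : OrientedGraph) where

  arc? : ∀ i j → Dec (Arc D i j)
  arc? i j = arc D i j ≟ᵇ true

  missing? : ∀ i j → Dec (Missing D i j)
  missing? i j = ¬? (i ≟ᶠ j) ×-dec (arc D i j ≟ᵇ false) ×-dec (arc D j i ≟ᵇ false)

  inN+∪N++? : ∀ x v → Dec (InN+ D x v ⊎ InN++ D x v)
  inN+∪N++? x v = arc? x v ⊎-dec ¬? (arc? x v) ×-dec any? (λ y → arc? x y ×-dec arc? y v)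

  losesLab? : ∀ x₁ y₁ x₂ y₂ → Dec (LosesLab D x₁ y₁ x₂ y₂)
  losesLab? x₁ y₁ x₂ y₂ =
    arc? x₁ x₂ ×-dec ¬? (inN+∪N++? x₁ y₂) ×-dec arc? y₁ y₂ ×-dec ¬? (inN+∪N++? y₁ x₂)

  loses? : ∀ e f → Dec (Loses D e f)
  loses? (a , b) (c , d) =
    losesLab? a b c d ⊎-dec losesLab? a b d c ⊎-dec losesLab? b a c d ⊎-dec losesLab? b a d c

  isMEdge? : ∀ e → Dec (IsMEdge D e)
  isMEdge? (a , b) = (a <ᶠ? b) ×-dec missing? a b

edge? : (G : Graph) → ∀ a b → Dec (Edge G a b)
edge? G a b = adj G a b ≟ᵇ true

module _ (G : Graph) (a : Fin (m G) → Fin (m G) → Bool) {o : True (isOrientation? a)} where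

  private
    D : OrientedGraph
    D = orientedGraph a {o}

  missingIs-identity : (∀ i → ∃[ j ] Missing D i j) → (∀ i j → Missing D i j ⇔ Edge G i j) →
                       MissingIs D G
  missingIs-identity covered edges = (λ i → i) , (λ _ _ eq → eq) , covered , (λ i _ _ → i , refl) , edges

  missingIs-identity? : Dec ((∀ i → ∃[ j ] Missing D i j) × (∀ i j → Missing D i j ⇔ Edge G i j))
  missingIs-identity? =
    all? (λ i → any? (missing? D i)) ×-dec all? (λ i → all? λ j → missing? D i j ⇔-dec edge? G i j)

module _ (D : OrientedGraph) where

  DeltaInPaths⇒¬2-cycle : ∀ {e f} → DeltaInPaths D → IsMEdge D e → IsMEdge D f →
                          Loses D e f → ¬ Loses D f e
  DeltaInPaths⇒¬2-cycle (_ , _ , unique , _ , loses⇔) e∈ f∈ ef fe =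
    Adjacent-asym unique (Consecutive⇒Adjacent (Equivalence.to (loses⇔ _ _ e∈ f∈) ef))
                         (Consecutive⇒Adjacent (Equivalence.to (loses⇔ _ _ f∈ e∈) fe))

  DeltaInPaths⇒in-degree≤1 : ∀ {e f g} → DeltaInPaths D → IsMEdge D e → IsMEdge D f → IsMEdge D g →
                             Loses D f e → Loses D g e → f ≡ g
  DeltaInPaths⇒in-degree≤1 (_ , _ , unique , _ , loses⇔) e∈ f∈ g∈ fe ge =
    Adjacent-predecessor unique (Consecutive⇒Adjacent (Equivalence.to (loses⇔ _ _ f∈ e∈) fe))
                                (Consecutive⇒Adjacent (Equivalence.to (loses⇔ _ _ g∈ e∈) ge))

coC4-arcs : Fin 4 → Fin 4 → Bool
coC4-arcs i j = arcs (toℕ i) (toℕ j)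
  where
    arcs : ℕ → ℕ → Bool
    arcs 0 3 = true
    arcs 3 2 = true
    arcs 2 1 = true
    arcs 1 0 = true
    arcs _ _ = false

¬InFP-coC4 : ¬ InFP coC4
¬InFP-coC4 inFP = DeltaInPaths⇒¬2-cycle D (inFP D missingIs)
  (from-yes (isMEdge? D e)) (from-yes (isMEdge? D f)) (from-yes (loses? D e f)) (from-yes (loses? D f e))
  where
    D : OrientedGraph
    D = orientedGraph coC4-arcs
    e f : MEdge D
    e = # 0 , # 2
    f = # 1 , # 3
    missingIs : MissingIs D coC4
    missingIs = uncurry (missingIs-identity coC4 coC4-arcs)
                        (from-yes (missingIs-identity? coC4 coC4-arcs))

chair-arcs : Fin 5 → Fin 5 → Bool
chair-arcs i j = arcs (toℕ i) (toℕ j)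
  where
    arcs : ℕ → ℕ → Bool
    arcs 0 3 = true
    arcs 0 4 = true
    arcs 2 0 = true
    arcs 3 1 = true
    arcs 4 1 = true
    arcs 4 3 = true
    arcs _ _ = false

¬InFP-chair : ¬ InFP chair
¬InFP-chair inFP = f≢g (DeltaInPaths⇒in-degree≤1 D (inFP D missingIs)
  (from-yes (isMEdge? D e)) (from-yes (isMEdge? D f)) (from-yes (isMEdge? D g))
  (from-yes (loses? D f e)) (from-yes (loses? D g e)))
  where
    D : OrientedGraph
    D = orientedGraph chair-arcs
    e f g : MEdge D
    e = # 0 , # 1
    f = # 2 , # 3
    g = # 2 , # 4
    f≢g : f ≢ g
    f≢g ()
    missingIs : MissingIs D chair
    missingIs = uncurry (missingIs-identity chair chair-arcs)
                        (from-yes (missingIs-identity? chair chair-arcs))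

coChair-arcs : Fin 5 → Fin 5 → Bool
coChair-arcs i j = arcs (toℕ i) (toℕ j)
  where
    arcs : ℕ → ℕ → Bool
    arcs 1 0 = true
    arcs 2 1 = true
    arcs 3 2 = true
    arcs 4 2 = true
    arcs _ _ = false

¬InFP-coChair : ¬ InFP coChair
¬InFP-coChair inFP = f≢g (DeltaInPaths⇒in-degree≤1 D (inFP D missingIs)
  (from-yes (isMEdge? D e)) (from-yes (isMEdge? D f)) (from-yes (isMEdge? D g))
  (from-yes (loses? D f e)) (from-yes (loses? D g e)))
  where
    D : OrientedGraph
    D = orientedGraph coChair-arcs
    e f g : MEdge D
    e = # 0 , # 2
    f = # 1 , # 3
    g = # 1 , # 4
    f≢g : f ≢ g
    f≢g ()
    missingIs : MissingIs D coChair
    missingIs = uncurry (missingIs-identity coChair coChair-arcs)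
                        (from-yes (missingIs-identity? coChair coChair-arcs))

mainTheorem4 : ¬ InFP coC4 × ¬ InFP chair × ¬ InFP coChair
mainTheorem4 = ¬InFP-coC4 , ¬InFP-chair , ¬InFP-coChair
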